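{- Let $\mathfrak{A}\in\mathrm{REL}$ be a perfect algebra and let $a,b$ be atoms of $\mathfrak{A}$ with $\breve{a}\neq0$ and $\breve{b}\neq0$. Then: (1) $\breve{a}$ is an atom of $\mathfrak{A}$; (2) $\breve{\breve{a}}\neq0$ and $\breve{\breve{a}}=a$; (3) if $\breve{a}=\breve{b}$ then $a=b$.
   Context: $\mathrm{REL}$ is the class of algebras $\mathfrak{A}=\langle A,+,\cdot,-,0,1,;,\breve{\ },1'\rangle$ (binary $;$, unary converse $x\mapsto\breve{x}$, constant $1'$) satisfying: (Ax1) $\langle A,+,\cdot,-,0,1\rangle$ is a Boolean algebra; (Ax2) $(x\cdot\breve{y})\breve{}=\breve{x}\cdot y$; (Ax3) $(x+y);z=x;z+y;z$ and $x;(y+z)=x;y+x;z$; (Ax4) $1;0=0$ and $0;1=0$; (Ax5) $(\breve{x};y)\cdot z=(\breve{x};(y\cdot(\breve{\breve{x}};z)))\cdot z$ and $(x;\breve{y})\cdot z=((x\cdot(z;\breve{\breve{y}}));\breve{y})\cdot z$; (Ax6) $1';x\le x$ and $x;1'\le x$; (Ax7) $1';1'=1'$; (Ax8) $(-(\breve{1});-(\breve{1}))\cdot 1'=0$; (Ax9) $((x\cdot1');y);z=(x\cdot1');(y;z)$, $(x;(y\cdot1'));z=x;((y\cdot1');z)$ and $(x;y);(z\cdot1')=x;(y;(z\cdot1'))$. An algebra $\mathfrak{A}\in\mathrm{REL}$ is perfect if it is complete and atomic (as a Boolean algebra) and its converse and composition operations are completely additive. -}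

module Defs where

open import Level using (Level; _⊔_) renaming (suc to lsuc)
open import Data.Product using (Σ; ∃; _×_; _,_)
open import Data.Sum using (_⊎_)
open import Relation.Nullary using (¬_)
open import Relation.Unary using (Pred)
open import Algebra.Core using (Op₁; Op₂)
open import Algebra.Lattice.Bundles using (BooleanAlgebra)

-- Notation: x + y = x ∨ y, x · y = x ∧ y, - x = ¬ x, 0 = ⊥, 1 = ⊤,
-- composition x ; y, converse x ˘, identity 1'.
record REL (c ℓ : Level) : Set (lsuc (c ⊔ ℓ)) where
  infixl 9 _˘
  infixr 7 _⨾_
  field
    booleanAlgebra : BooleanAlgebra c ℓ
  open BooleanAlgebra booleanAlgebra public renaming (¬_ to -_)
  field
    _⨾_  : Op₂ Carrier
    _˘   : Op₁ Carrier
    1'   : Carrier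
    ⨾-cong : ∀ {x x' y y'} → x ≈ x' → y ≈ y' → (x ⨾ y) ≈ (x' ⨾ y')
    ˘-cong : ∀ {x x'} → x ≈ x' → (x ˘) ≈ (x' ˘)
    ax2  : ∀ x y → ((x ∧ (y ˘)) ˘) ≈ ((x ˘) ∧ y)
    ax3ˡ : ∀ x y z → ((x ∨ y) ⨾ z) ≈ ((x ⨾ z) ∨ (y ⨾ z))
    ax3ʳ : ∀ x y z → (x ⨾ (y ∨ z)) ≈ ((x ⨾ y) ∨ (x ⨾ z))
    ax4ˡ : (⊤ ⨾ ⊥) ≈ ⊥
    ax4ʳ : (⊥ ⨾ ⊤) ≈ ⊥
    ax5ˡ : ∀ x y z → (((x ˘) ⨾ y) ∧ z) ≈ (((x ˘) ⨾ (y ∧ ((x ˘ ˘) ⨾ z))) ∧ z)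
    ax5ʳ : ∀ x y z → ((x ⨾ (y ˘)) ∧ z) ≈ (((x ∧ (z ⨾ (y ˘ ˘))) ⨾ (y ˘)) ∧ z)
    -- (Ax6)  (x ≤ y is x + y = y)
    ax6ˡ : ∀ x → ((1' ⨾ x) ∨ x) ≈ x
    ax6ʳ : ∀ x → ((x ⨾ 1') ∨ x) ≈ x
    ax7  : (1' ⨾ 1') ≈ 1'
    ax8  : (((- (⊤ ˘)) ⨾ (- (⊤ ˘))) ∧ 1') ≈ ⊥
    ax9a : ∀ x y z → (((x ∧ 1') ⨾ y) ⨾ z) ≈ ((x ∧ 1') ⨾ (y ⨾ z))
    ax9b : ∀ x y z → ((x ⨾ (y ∧ 1')) ⨾ z) ≈ (x ⨾ ((y ∧ 1') ⨾ z))
    ax9c : ∀ x y z → ((x ⨾ y) ⨾ (z ∧ 1')) ≈ (x ⨾ (y ⨾ (z ∧ 1')))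

  infix 4 _≤_
  _≤_ : Carrier → Carrier → Set ℓ
  x ≤ y = (x ∨ y) ≈ y

  IsAtom : Carrier → Set (c ⊔ ℓ)
  IsAtom a = (¬ (a ≈ ⊥)) × (∀ x → x ≤ a → (x ≈ ⊥) ⊎ (x ≈ a))

  IsSup : Pred Carrier (c ⊔ ℓ) → Carrier → Set (c ⊔ ℓ)
  IsSup P s = (∀ x → P x → x ≤ s) × (∀ u → (∀ x → P x → x ≤ u) → s ≤ u)

  ImgConv : Pred Carrier (c ⊔ ℓ) → Pred Carrier (c ⊔ ℓ)
  ImgConv P y = Σ Carrier λ x → P x × (y ≈ (x ˘))

  ImgCompR : Pred Carrier (c ⊔ ℓ) → Carrier → Pred Carrier (c ⊔ ℓ)
  ImgCompR P z y = Σ Carrier λ x → P x × (y ≈ (x ⨾ z))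

  ImgCompL : Carrier → Pred Carrier (c ⊔ ℓ) → Pred Carrier (c ⊔ ℓ)
  ImgCompL z P y = Σ Carrier λ x → P x × (y ≈ (z ⨾ x))

  IsComplete : Set (lsuc (c ⊔ ℓ))
  IsComplete = ∀ (P : Pred Carrier (c ⊔ ℓ)) → ∃ λ s → IsSup P s

  IsAtomic : Set (c ⊔ ℓ)
  IsAtomic = ∀ x → ¬ (x ≈ ⊥) → ∃ λ a → IsAtom a × (a ≤ x)

  CompletelyAdditive : Set (lsuc (c ⊔ ℓ))
  CompletelyAdditive =
    ∀ (P : Pred Carrier (c ⊔ ℓ)) s → IsSup P s →
      IsSup (ImgConv P) (s ˘)
      × (∀ z → IsSup (ImgCompR P z) (s ⨾ z))
      × (∀ z → IsSup (ImgCompL z P) (z ⨾ s))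

  IsPerfect : Set (lsuc (c ⊔ ℓ))
  IsPerfect = IsComplete × IsAtomic × CompletelyAdditive

-- Axiom (Ax2) alone gives x ˘ ˘ ≈ ⊤ ˘ ∧ x, so the converse is an involution
-- on the elements below ⊤ ˘, and it turns x ≤ y ˘ into x ˘ ≤ y.  An atom a
-- with a ˘ ≠ 0 lies below ⊤ ˘: otherwise a ∧ ⊤ ˘ = 0 and a ˘ = (a ∧ ⊤ ˘) ˘ = 0.
-- In a perfect algebra the converse is monotone, so everything below a ˘ lies
-- below ⊤ ˘; the involution then carries the downset of a ˘ into that of a,
-- which makes a ˘ an atom.
module Submission where

open import Defs
open import Level using (Lift; lift; lower)
open import Data.Product using (_×_; _,_; proj₁)
open import Data.Sum using (_⊎_; [_,_]′)
import Data.Sum as Sum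
open import Relation.Nullary using (¬_; contradiction)
import Algebra.Lattice.Properties.BooleanAlgebra as BooleanAlgebraProperties
import Relation.Binary.Reasoning.Setoid as SetoidReasoning

module Properties {c ℓ} (𝔄 : REL c ℓ) where
  open REL 𝔄
  open BooleanAlgebraProperties booleanAlgebra
  open SetoidReasoning setoid

  ≤⇒∧≈ : ∀ {x y} → x ≤ y → (x ∧ y) ≈ x
  ≤⇒∧≈ {x} {y} x≤y = trans (∧-congˡ (sym x≤y)) (∧-absorbs-∨ x y)

  ∧≈⇒≤ : ∀ {x y} → (x ∧ y) ≈ x → x ≤ y
  ∧≈⇒≤ {x} {y} x∧y≈x = begin
    x ∨ y        ≈⟨ ∨-congʳ (sym x∧y≈x) ⟩
    (x ∧ y) ∨ y  ≈⟨ ∨-comm _ y ⟩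
    y ∨ (x ∧ y)  ≈⟨ ∨-congˡ (∧-comm x y) ⟩
    y ∨ (y ∧ x)  ≈⟨ ∨-absorbs-∧ y x ⟩
    y            ∎

  ≤-trans : ∀ {x y z} → x ≤ y → y ≤ z → x ≤ z
  ≤-trans {x} {y} {z} x≤y y≤z = begin
    x ∨ z        ≈⟨ ∨-congˡ (sym y≤z) ⟩
    x ∨ (y ∨ z)  ≈⟨ ∨-assoc x y z ⟨
    (x ∨ y) ∨ z  ≈⟨ ∨-congʳ x≤y ⟩
    y ∨ z        ≈⟨ y≤z ⟩
    z            ∎

  x∧y≤x : ∀ x y → (x ∧ y) ≤ x
  x∧y≤x x y = trans (∨-comm _ x) (∨-absorbs-∧ x y)

  x≤⊤ : ∀ x → x ≤ ⊤
  x≤⊤ = ∨-zeroʳ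

  ⊥˘≈⊥ : (⊥ ˘) ≈ ⊥
  ⊥˘≈⊥ = begin
    ⊥ ˘              ≈⟨ ˘-cong (∧-zeroˡ (⊥ ˘)) ⟨
    (⊥ ∧ (⊥ ˘)) ˘    ≈⟨ ax2 ⊥ ⊥ ⟩
    (⊥ ˘) ∧ ⊥        ≈⟨ ∧-zeroʳ _ ⟩
    ⊥                ∎

  [x∧⊤˘]˘≈x˘ : ∀ x → ((x ∧ (⊤ ˘)) ˘) ≈ (x ˘)
  [x∧⊤˘]˘≈x˘ x = trans (ax2 x ⊤) (∧-identityʳ _)

  x˘˘≈⊤˘∧x : ∀ x → (x ˘ ˘) ≈ ((⊤ ˘) ∧ x)
  x˘˘≈⊤˘∧x x = trans (˘-cong (sym (∧-identityˡ _))) (ax2 ⊤ x)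

  ˘-involutive-below-⊤˘ : ∀ {x} → x ≤ (⊤ ˘) → (x ˘ ˘) ≈ x
  ˘-involutive-below-⊤˘ {x} x≤⊤˘ = begin
    x ˘ ˘          ≈⟨ x˘˘≈⊤˘∧x x ⟩
    (⊤ ˘) ∧ x      ≈⟨ ∧-comm _ x ⟩
    x ∧ (⊤ ˘)      ≈⟨ ≤⇒∧≈ x≤⊤˘ ⟩
    x              ∎

  ˘-injective-below-⊤˘ : ∀ {x y} → x ≤ (⊤ ˘) → y ≤ (⊤ ˘) → (x ˘) ≈ (y ˘) → x ≈ y
  ˘-injective-below-⊤˘ {x} {y} x≤⊤˘ y≤⊤˘ x˘≈y˘ = begin
    x          ≈⟨ ˘-involutive-below-⊤˘ x≤⊤˘ ⟨
    x ˘ ˘      ≈⟨ ˘-cong x˘≈y˘ ⟩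
    y ˘ ˘      ≈⟨ ˘-involutive-below-⊤˘ y≤⊤˘ ⟩
    y          ∎

  ≤˘⇒˘≤ : ∀ {x y} → x ≤ (y ˘) → (x ˘) ≤ y
  ≤˘⇒˘≤ {x} {y} x≤y˘ = ∧≈⇒≤ (trans (sym (ax2 x y)) (˘-cong (≤⇒∧≈ x≤y˘)))

  atom≤⊤˘ : ∀ {a} → IsAtom a → ¬ ((a ˘) ≈ ⊥) → a ≤ (⊤ ˘)
  atom≤⊤˘ {a} (_ , minimal) a˘≉⊥ =
    [ (λ a∧⊤˘≈⊥ → contradiction (a˘≈⊥ a∧⊤˘≈⊥) a˘≉⊥) , ∧≈⇒≤ ]′
      (minimal (a ∧ (⊤ ˘)) (x∧y≤x a (⊤ ˘)))
    where
      a˘≈⊥ : (a ∧ (⊤ ˘)) ≈ ⊥ → (a ˘) ≈ ⊥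
      a˘≈⊥ a∧⊤˘≈⊥ = begin
        a ˘              ≈⟨ [x∧⊤˘]˘≈x˘ a ⟨
        (a ∧ (⊤ ˘)) ˘    ≈⟨ ˘-cong a∧⊤˘≈⊥ ⟩
        ⊥ ˘              ≈⟨ ⊥˘≈⊥ ⟩
        ⊥                ∎

  -- y is the join of its lifted downset, so complete additivity yields x ˘ ≤ y ˘.
  ˘-monotone : CompletelyAdditive → ∀ {x y} → x ≤ y → (x ˘) ≤ (y ˘)
  ˘-monotone additive {x} {y} x≤y =
    proj₁ (proj₁ (additive Below y y-isSup)) (x ˘) (x , lift x≤y , refl)
    where
      Below : Carrier → Set _
      Below z = Lift c (z ≤ y)

      y-isSup : IsSup Below y
      y-isSup = (λ z z≤y → lower z≤y) , (λ u bounded → bounded y (lift (∨-idem y)))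

  ˘-preserves-atom : (∀ x → (x ˘) ≤ (⊤ ˘)) →
    ∀ {a} → IsAtom a → ¬ ((a ˘) ≈ ⊥) → IsAtom (a ˘)
  ˘-preserves-atom x˘≤⊤˘ {a} (_ , minimal) a˘≉⊥ = a˘≉⊥ , minimal˘
    where
      minimal˘ : ∀ x → x ≤ (a ˘) → (x ≈ ⊥) ⊎ (x ≈ (a ˘))
      minimal˘ x x≤a˘ = Sum.map
        (λ x˘≈⊥ → trans x≈x˘˘ (trans (˘-cong x˘≈⊥) ⊥˘≈⊥))
        (λ x˘≈a → trans x≈x˘˘ (˘-cong x˘≈a))
        (minimal (x ˘) (≤˘⇒˘≤ x≤a˘))
        where
          x≈x˘˘ : x ≈ (x ˘ ˘)
          x≈x˘˘ = sym (˘-involutive-below-⊤˘ (≤-trans x≤a˘ (x˘≤⊤˘ a)))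

lemma2p2 : ∀ {c ℓ} (𝔄 : REL c ℓ) → REL.IsPerfect 𝔄 →
    ∀ a b → REL.IsAtom 𝔄 a → REL.IsAtom 𝔄 b →
    ¬ (REL._≈_ 𝔄 (REL._˘ 𝔄 a) (REL.⊥ 𝔄)) → ¬ (REL._≈_ 𝔄 (REL._˘ 𝔄 b) (REL.⊥ 𝔄)) →
    REL.IsAtom 𝔄 (REL._˘ 𝔄 a)
    × (¬ (REL._≈_ 𝔄 (REL._˘ 𝔄 (REL._˘ 𝔄 a)) (REL.⊥ 𝔄))
       × REL._≈_ 𝔄 (REL._˘ 𝔄 (REL._˘ 𝔄 a)) a)
    × (REL._≈_ 𝔄 (REL._˘ 𝔄 a) (REL._˘ 𝔄 b) → REL._≈_ 𝔄 a b)
lemma2p2 𝔄 (_ , _ , additive) a b a-atom@(a≉⊥ , _) b-atom a˘≉⊥ b˘≉⊥ =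
  ˘-preserves-atom x˘≤⊤˘ a-atom a˘≉⊥ ,
  ((λ a˘˘≈⊥ → a≉⊥ (trans (sym a˘˘≈a) a˘˘≈⊥)) , a˘˘≈a) ,
  ˘-injective-below-⊤˘ a≤⊤˘ (atom≤⊤˘ b-atom b˘≉⊥)
  where
    open REL 𝔄
    open Properties 𝔄

    x˘≤⊤˘ : ∀ x → (x ˘) ≤ (⊤ ˘)
    x˘≤⊤˘ x = ˘-monotone additive (x≤⊤ x)

    a≤⊤˘ : a ≤ (⊤ ˘)
    a≤⊤˘ = atom≤⊤˘ a-atom a˘≉⊥

    a˘˘≈a : (a ˘ ˘) ≈ a
    a˘˘≈a = ˘-involutive-below-⊤˘ a≤⊤˘
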